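{- Let $G$ be a connected graph on $n\ge 2$ vertices and let $C_G=G\odot K_1$. Then $\alpha_{bn}(C_G)=n+\alpha(G)$, where $\alpha(G)$ is the independence number of $G$.
   Context: $G\odot K_1$ (the corona of $G$ with $K_1$) is obtained from $G$ by attaching to each vertex $v$ of $G$ a new pendant vertex (leaf) adjacent only to $v$. A broadcast on a connected graph $H$ is a function $f:V(H)\to\{0,1,\dots,\operatorname{diam}(H)\}$ with $f(v)\le e(v)$ (the eccentricity of $v$). Let $V_f^+=\{v: f(v)>0\}$. A vertex $u$ hears $f$ from $v\in V_f^+$ if $d_H(u,v)\le f(v)$; $N_f(v)$ is the set of vertices hearing $f$ from $v$ (including $v$), $PN_f(v)$ the set of vertices hearing $f$ only from $v$, and $B_f(v)=\{u\in N_f(v): d_H(u,v)=f(v)\}$. The broadcast $f$ is boundary independent if $N_f(v)\setminus B_f(v)\subseteq PN_f(v)$ for all $v\in V_f^+$. The cost is $\sigma(f)=\sum_v f(v)$, and $\alpha_{bn}(H)$ is the maximum cost of a boundary independent broadcast on $H$. -}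

module Defs where

open import Level using (0ℓ)
open import Data.Nat using (ℕ; zero; suc; _+_; _≤_; _<_; pred)
open import Data.Fin using (Fin; splitAt)
open import Data.Fin.Subset using (Subset; _∈_; ∣_∣)
open import Data.List using (map; allFin)
open import Data.Nat.ListAction using (sum)
open import Data.Sum using (_⊎_; inj₁; inj₂)
open import Data.Product using (Σ; _×_; ∃)
open import Data.Empty using (⊥)
open import Relation.Nullary using (¬_)
open import Relation.Binary.PropositionalEquality using (_≡_; refl)

record Graph (n : ℕ) : Set₁ where
  field
    Adj    : Fin n → Fin n → Set
    adj-sym : ∀ {u v} → Adj u v → Adj v u
    irrefl : ∀ {u} → ¬ Adj u u
open Graph public

-- Reach G k u v : there is a walk from u to v of length at most k,
-- i.e. d_G(u,v) ≤ k.
data Reach {n : ℕ} (G : Graph n) : ℕ → Fin n → Fin n → Set where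
  here : ∀ {k u} → Reach G k u u
  step : ∀ {k u w v} → Adj G u w → Reach G k w v → Reach G (suc k) u v

Connected : ∀ {n} → Graph n → Set
Connected {n} G = (u v : Fin n) → ∃ λ k → Reach G k u v

Independent : ∀ {n} → Graph n → Subset n → Set
Independent {n} G S = (i j : Fin n) → i ∈ S → j ∈ S → ¬ Adj G i j

IsIndependenceNumber : ∀ {n} → Graph n → ℕ → Set
IsIndependenceNumber {n} G a =
  (Σ (Subset n) λ S → Independent G S × ∣ S ∣ ≡ a)
  × ((S : Subset n) → Independent G S → ∣ S ∣ ≤ a)

-- Corona G ⊙ K₁ on Fin (n + n): the first n vertices are those of G,
-- vertex n + i is the leaf attached to vertex i.
CAdj' : ∀ {n} → Graph n → Fin n ⊎ Fin n → Fin n ⊎ Fin n → Set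
CAdj' G (inj₁ i) (inj₁ j) = Adj G i j
CAdj' G (inj₁ i) (inj₂ j) = i ≡ j
CAdj' G (inj₂ i) (inj₁ j) = i ≡ j
CAdj' G (inj₂ i) (inj₂ j) = ⊥

CAdj'-sym : ∀ {n} (G : Graph n) x y → CAdj' G x y → CAdj' G y x
CAdj'-sym G (inj₁ i) (inj₁ j) a = adj-sym G a
CAdj'-sym G (inj₁ i) (inj₂ j) e = Relation.Binary.PropositionalEquality.sym e
CAdj'-sym G (inj₂ i) (inj₁ j) e = Relation.Binary.PropositionalEquality.sym e
CAdj'-sym G (inj₂ i) (inj₂ j) ()

CAdj'-irrefl : ∀ {n} (G : Graph n) x → ¬ CAdj' G x x
CAdj'-irrefl G (inj₁ i) a = irrefl G a
CAdj'-irrefl G (inj₂ i) ()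

corona : ∀ {n} → Graph n → Graph (n + n)
corona {n} G = record
  { Adj    = λ u v → CAdj' G (splitAt n u) (splitAt n v)
  ; adj-sym = λ {u} {v} → CAdj'-sym G (splitAt n u) (splitAt n v)
  ; irrefl = λ {u} → CAdj'-irrefl G (splitAt n u)
  }

-- Broadcasts.  f v ≤ e(v) is expressed as: some vertex u has d(v,u) ≥ f v,
-- i.e. every walk-length bound m reaching u from v satisfies f v ≤ m.
-- (This also gives f v ≤ diam.)
IsBroadcast : ∀ {n} → Graph n → (Fin n → ℕ) → Set
IsBroadcast {n} G f = (v : Fin n) → ∃ λ u → (m : ℕ) → Reach G m v u → f v ≤ m

Hears : ∀ {n} → Graph n → (Fin n → ℕ) → Fin n → Fin n → Set
Hears G f u v = (0 < f v) × Reach G (f v) v u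

-- Boundary independence: for v ∈ V_f^+, every u with d(u,v) < f v
-- (i.e. u ∈ N_f(v) ∖ B_f(v)) hears f only from v (u ∈ PN_f(v)).
BoundaryIndependent : ∀ {n} → Graph n → (Fin n → ℕ) → Set
BoundaryIndependent {n} G f =
  (v : Fin n) → 0 < f v → (u : Fin n) → Reach G (pred (f v)) v u →
  (w : Fin n) → Hears G f u w → w ≡ v

cost : ∀ {n} → (Fin n → ℕ) → ℕ
cost {n} f = sum (map f (allFin n))

IsBNBroadcast : ∀ {n} → Graph n → (Fin n → ℕ) → Set
IsBNBroadcast G f = IsBroadcast G f × BoundaryIndependent G f

IsAlphaBN : ∀ {n} → Graph n → ℕ → Set
IsAlphaBN {n} G b =
  (Σ (Fin n → ℕ) λ f → IsBNBroadcast G f × cost f ≡ b)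
  × ((f : Fin n → ℕ) → IsBNBroadcast G f → cost f ≤ b)

-- Lower bound: give strength 2 to the leaves of a maximum independent set S of G and
-- strength 1 to all other leaves.  Two leaves are at distance at least 3, and exactly 3
-- only when their bases are adjacent, so no two of these balls meet in their interiors.
--
-- Upper bound: let a vertex g of G be owned by its leaf if that leaf broadcasts, and
-- otherwise by the only broadcaster g hears, if there is one.  A broadcasting vertex x
-- has a vertex at distance at least f x; the first vertices of a shortest path from (the
-- base of) x towards it lie in the interior of the ball of x, so x owns at least f x of
-- them, or f x − 1 if x is a leaf with f x ≥ 2.  Owners being unique, the cost is at most
-- n plus the number of leaves of strength at least 2, and boundary independence forces the
-- bases of those leaves to be independent in G.

module Submission where

open import Defs
open import Data.Bool using (Bool; true; false; T)
open import Data.Empty using (⊥-elim)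
open import Data.Fin as Fin using (Fin; _↑ˡ_; _↑ʳ_; splitAt; punchIn)
open import Data.Fin.Properties using (join-splitAt; ↑ˡ-injective; ↑ʳ-injective; splitAt-↑ˡ; splitAt-↑ʳ; punchInᵢ≢i; injective⇒≤)
open import Data.Fin.Subset using (Subset; _∈_; ∣_∣)
open import Data.List using (List; []; _∷_; [_]; length; take; concat; tabulate; lookup)
open import Data.List.Properties using (map-tabulate; length-++; length-take)
open import Data.List.Membership.Propositional using () renaming (_∈_ to _∈ₗ_)
open import Data.List.Membership.Propositional.Properties using (∈-lookup)
open import Data.List.Relation.Unary.Any as Any using ()
open import Data.List.Relation.Unary.All as All using (All; []; _∷_)
open import Data.List.Relation.Unary.All.Properties using (¬Any⇒All¬)
open import Data.List.Relation.Unary.AllPairs using ([]; _∷_)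
open import Data.List.Relation.Unary.Unique.Propositional using (Unique)
open import Data.List.Relation.Binary.Disjoint.Propositional using (Disjoint)
import Data.List.Relation.Unary.All.Properties as All
import Data.List.Relation.Unary.AllPairs.Properties as AllPairs
import Data.List.Relation.Unary.Unique.Propositional.Properties as Unique
import Data.Nat.ListAction as ListAction
open import Data.Nat using (ℕ; zero; suc; _+_; _≤_; _<_; _≤?_; _≤ᵇ_; z<s; pred; z≤n; s≤s; s≤s⁻¹; >-nonZero)
open import Data.Nat.Properties
open import Data.Product using (_×_; ∃; _,_; proj₁; proj₂)
open import Data.Sum using (_⊎_; inj₁; inj₂)
open import Data.Sum.Properties using ([,]-map)
open import Data.Vec as Vec using (_∷_)
open import Data.Vec.Properties using (lookup⇒[]=; []=⇒lookup; lookup∘tabulate)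
open import Data.Vec.Functional using (Vector; replicate; _++_)
open import Data.Vec.Functional.Properties using (lookup-++ˡ; lookup-++ʳ)
open import Function using (_∘_)
open import Relation.Nullary using (¬_; yes; no; contradiction)
open import Relation.Binary.PropositionalEquality using (_≡_; _≢_; refl; sym; trans; cong; cong₂; subst; module ≡-Reasoning)
open import Algebra.Properties.CommutativeMonoid.Sum +-0-commutativeMonoid
  using (sum; sum-cong-≗; ∑-distrib-+; sum-replicate-zero)
open import Algebra.Properties.CommutativeSemigroup +-commutativeSemigroup using (x∙yz≈y∙xz)

module Walks {n : ℕ} (G : Graph n) where

  Reach-mono : ∀ {k l u v} → Reach G k u v → k ≤ l → Reach G l u v
  Reach-mono here       _         = here
  Reach-mono (step a r) (s≤s k≤l) = step a (Reach-mono r k≤l)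

  Reach-zero : ∀ {u v} → Reach G 0 u v → u ≡ v
  Reach-zero here = refl

  Reach-suc : ∀ {k u v} → Reach G (suc k) u v → u ≡ v ⊎ ∃ λ w → Adj G u w × Reach G k w v
  Reach-suc here       = inj₁ refl
  Reach-suc (step a r) = inj₂ (_ , a , r)

  Reach-++ : ∀ {k l u w v} → Reach G k u w → Reach G l w v → Reach G (k + l) u v
  Reach-++ {l = l} here r = Reach-mono r (m≤n+m l _)
  Reach-++ (step a r) r′  = step a (Reach-++ r r′)

  Reach-snoc : ∀ {k u w v} → Reach G k u w → Adj G w v → Reach G (suc k) u v
  Reach-snoc here       a = step a here
  Reach-snoc (step b r) a = step b (Reach-snoc r a)

  Reach-sym : ∀ {k u v} → Reach G k u v → Reach G k v u
  Reach-sym here       = here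
  Reach-sym (step a r) = Reach-snoc (Reach-sym r) (adj-sym G a)

  data WalkVia : Fin n → Fin n → List (Fin n) → Set where
    []  : ∀ {j} → WalkVia j j []
    _∷_ : ∀ {i w j ws} → Adj G i w → WalkVia w j ws → WalkVia i j (w ∷ ws)

  WalkVia⇒Reach : ∀ {i j ws} → WalkVia i j ws → Reach G (length ws) i j
  WalkVia⇒Reach []      = here
  WalkVia⇒Reach (a ∷ p) = step a (WalkVia⇒Reach p)

  WalkVia-prefix : ∀ {i j ws} → WalkVia i j ws → ∀ c → All (Reach G c i) (i ∷ take c ws)
  WalkVia-prefix []      zero    = here ∷ []
  WalkVia-prefix []      (suc c) = here ∷ []
  WalkVia-prefix (a ∷ p) zero    = here ∷ []
  WalkVia-prefix (a ∷ p) (suc c) = here ∷ All.map (step a) (WalkVia-prefix p c)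

  SimpleWalk : Fin n → Fin n → Set
  SimpleWalk i j = ∃ λ ws → WalkVia i j ws × Unique (i ∷ ws)

  SimpleWalk-from : ∀ {i j ws v} → WalkVia i j ws → Unique (i ∷ ws) → v ∈ₗ (i ∷ ws) → SimpleWalk v j
  SimpleWalk-from p       u       (Any.here refl) = _ , p , u
  SimpleWalk-from (a ∷ p) (_ ∷ u) (Any.there v∈) = SimpleWalk-from p u v∈

  open import Data.List.Membership.DecPropositional (Fin._≟_ {n}) using (_∈?_)

  Reach⇒SimpleWalk : ∀ {m i j} → Reach G m i j → SimpleWalk i j
  Reach⇒SimpleWalk here = [] , [] , [] ∷ []
  Reach⇒SimpleWalk {i = i} (step {w = w} a r) with Reach⇒SimpleWalk r
  ... | ws , p , u with i ∈? (w ∷ ws)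
  ...   | yes i∈ = SimpleWalk-from p u i∈
  ...   | no  i∉ = w ∷ ws , a ∷ p , ¬Any⇒All¬ _ i∉ ∷ u

  ball-lower-bound : ∀ {m k i j} → Reach G m i j → (∀ {l} → Reach G l i j → k ≤ l) →
    ∃ λ ys → Unique ys × length ys ≡ suc k × All (Reach G k i) ys
  ball-lower-bound {k = k} {i} r far with Reach⇒SimpleWalk r
  ... | ws , p , u =
    i ∷ take k ws ,
    Unique.take⁺ (suc k) u ,
    cong suc (trans (length-take k ws) (m≤n⇒m⊓n≡m (far (WalkVia⇒Reach p)))) ,
    WalkVia-prefix p k

  Separated : (Fin n → ℕ) → Set
  Separated f = ∀ {k v w} → v ≢ w → 0 < f v → 0 < f w → Reach G k v w → f v + f w ≤ k

  -- A vertex strictly inside the ball of v and heard from w ≠ v would give a walk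
  -- from v to w of length less than f v + f w.
  separated⇒boundaryIndependent : ∀ {f} → Separated f → BoundaryIndependent G f
  separated⇒boundaryIndependent {f} sep v fv>0 u r w (fw>0 , r′) with w Fin.≟ v
  ... | yes w≡v = w≡v
  ... | no  w≢v = contradiction fv≤pred[fv] (<⇒≱ (m≤pred[n]⇒suc[m]≤n {{>-nonZero fv>0}} ≤-refl))
    where
    fv≤pred[fv] : f v ≤ pred (f v)
    fv≤pred[fv] = +-cancelʳ-≤ (f w) (f v) (pred (f v))
      (sep (w≢v ∘ sym) fv>0 fw>0 (Reach-++ r (Reach-sym r′)))

sum-mono-≤ : ∀ {m} {f g : Vector ℕ m} → (∀ i → f i ≤ g i) → sum f ≤ sum g
sum-mono-≤ {zero}  f≤g = z≤n
sum-mono-≤ {suc m} f≤g = +-mono-≤ (f≤g Fin.zero) (sum-mono-≤ (f≤g ∘ Fin.suc))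

sum-++ : ∀ {m k} (xs : Vector ℕ m) (ys : Vector ℕ k) → sum (xs ++ ys) ≡ sum xs + sum ys
sum-++ {zero}      xs ys = refl
sum-++ {suc m}     xs ys = begin
  xs Fin.zero + sum ((xs ++ ys) ∘ Fin.suc)   ≡⟨ cong (xs Fin.zero +_) (sum-cong-≗ ([,]-map ∘ splitAt m)) ⟩
  xs Fin.zero + sum ((xs ∘ Fin.suc) ++ ys)   ≡⟨ cong (xs Fin.zero +_) (sum-++ (xs ∘ Fin.suc) ys) ⟩
  xs Fin.zero + (sum (xs ∘ Fin.suc) + sum ys) ≡⟨ +-assoc (xs Fin.zero) _ _ ⟨
  sum xs + sum ys                             ∎
  where open ≡-Reasoning

sum-suc : ∀ {m} (f : Vector ℕ m) → sum (suc ∘ f) ≡ m + sum f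
sum-suc {zero}  f = refl
sum-suc {suc m} f = cong suc (begin
  f Fin.zero + sum (suc ∘ f ∘ Fin.suc)   ≡⟨ cong (f Fin.zero +_) (sum-suc (f ∘ Fin.suc)) ⟩
  f Fin.zero + (m + sum (f ∘ Fin.suc))   ≡⟨ x∙yz≈y∙xz (f Fin.zero) m _ ⟩
  m + (f Fin.zero + sum (f ∘ Fin.suc))   ∎)
  where open ≡-Reasoning

cost≡sum : ∀ {m} (f : Fin m → ℕ) → cost f ≡ sum f
cost≡sum f = trans (cong ListAction.sum (map-tabulate (λ i → i) f)) (sum-tabulate f)
  where
  sum-tabulate : ∀ {k} (g : Fin k → ℕ) → ListAction.sum (tabulate g) ≡ sum g
  sum-tabulate {zero}  g = refl
  sum-tabulate {suc k} g = cong (g Fin.zero +_) (sum-tabulate (g ∘ Fin.suc))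

length-concat-tabulate : ∀ {m} {A : Set} (L : Fin m → List A) →
  length (concat (tabulate L)) ≡ sum (length ∘ L)
length-concat-tabulate {zero}  L = refl
length-concat-tabulate {suc m} L = trans (length-++ (L Fin.zero))
  (cong (length (L Fin.zero) +_) (length-concat-tabulate (L ∘ Fin.suc)))

Unique⇒length≤ : ∀ {m} {xs : List (Fin m)} → Unique xs → length xs ≤ m
Unique⇒length≤ u = injective⇒≤ (lookup-injective u)
  where
  lookup-injective : ∀ {ys : List (Fin _)} → Unique ys → ∀ {i j} → lookup ys i ≡ lookup ys j → i ≡ j
  lookup-injective (_  ∷ _) {Fin.zero}  {Fin.zero}  _ = refl
  lookup-injective (y∉ ∷ _) {Fin.zero}  {Fin.suc j} e = contradiction e (All.lookup y∉ (∈-lookup j))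
  lookup-injective (y∉ ∷ _) {Fin.suc i} {Fin.zero}  e = contradiction (sym e) (All.lookup y∉ (∈-lookup i))
  lookup-injective (_  ∷ u) {Fin.suc i} {Fin.suc j} e = cong Fin.suc (lookup-injective u e)

indicator : Bool → ℕ
indicator true  = 1
indicator false = 0

∣p∣≡sum-indicator : ∀ {m} (p : Subset m) → ∣ p ∣ ≡ sum (indicator ∘ Vec.lookup p)
∣p∣≡sum-indicator Vec.[]        = refl
∣p∣≡sum-indicator (true  ∷ p) = cong suc (∣p∣≡sum-indicator p)
∣p∣≡sum-indicator (false ∷ p) = ∣p∣≡sum-indicator p

another : ∀ {m} → 2 ≤ m → (i : Fin m) → ∃ λ j → j ≢ i
another {suc zero}    (s≤s ()) _
another {suc (suc _)} _        i = punchIn i Fin.zero , punchInᵢ≢i i Fin.zero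

module Corona {n : ℕ} (G : Graph n) where

  H : Graph (n + n)
  H = corona G

  open Walks H

  base leaf : Fin n → Fin (n + n)
  base i = i ↑ˡ n
  leaf i = n ↑ʳ i

  data Place : Fin (n + n) → Set where
    at-base : ∀ i → Place (base i)
    at-leaf : ∀ i → Place (leaf i)

  place : ∀ x → Place x
  place x with splitAt n x | join-splitAt n n x
  ... | inj₁ i | refl = at-base i
  ... | inj₂ i | refl = at-leaf i

  split-base : ∀ i → splitAt n (base i) ≡ inj₁ i
  split-base i = splitAt-↑ˡ n i n

  split-leaf : ∀ i → splitAt n (leaf i) ≡ inj₂ i
  split-leaf i = splitAt-↑ʳ n n i

  base-injective : ∀ {i j} → base i ≡ base j → i ≡ j
  base-injective = ↑ˡ-injective n _ _

  leaf-injective : ∀ {i j} → leaf i ≡ leaf j → i ≡ j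
  leaf-injective = ↑ʳ-injective n _ _

  leaf≢base : ∀ {i j} → leaf i ≢ base j
  leaf≢base {i} {j} e with trans (sym (split-leaf i)) (trans (cong (splitAt n) e) (split-base j))
  ... | ()

  private
    adj⁺ : ∀ {x y s t} → splitAt n x ≡ s → splitAt n y ≡ t → CAdj' G s t → Adj H x y
    adj⁺ refl refl a = a

    adj⁻ : ∀ {x y s t} → splitAt n x ≡ s → splitAt n y ≡ t → Adj H x y → CAdj' G s t
    adj⁻ refl refl a = a

  base-adj : ∀ {i j} → Adj G i j → Adj H (base i) (base j)
  base-adj = adj⁺ (split-base _) (split-base _)

  base-adj⁻ : ∀ {i j} → Adj H (base i) (base j) → Adj G i j
  base-adj⁻ = adj⁻ (split-base _) (split-base _)

  base-leaf-adj : ∀ i → Adj H (base i) (leaf i)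
  base-leaf-adj i = adj⁺ (split-base i) (split-leaf i) refl

  leaf-base-adj : ∀ i → Adj H (leaf i) (base i)
  leaf-base-adj i = adj-sym H (base-leaf-adj i)

  leaf-adj⁻ : ∀ {i y} → Adj H (leaf i) y → y ≡ base i
  leaf-adj⁻ {i} {y} a with place y
  ... | at-base j = cong base (sym (adj⁻ (split-leaf i) (split-base j) a))
  ... | at-leaf j = ⊥-elim (adj⁻ (split-leaf i) (split-leaf j) a)

  lift : ∀ {k i j} → Reach G k i j → Reach H k (base i) (base j)
  lift here       = here
  lift (step a r) = step (base-adj a) (lift r)

  -- Walks out of a leaf are analysed through Reach-suc: matching Reach directly against the
  -- endpoints leaf i and base j gets stuck, as _↑ʳ_ and _↑ˡ_ do not reduce for variable n.
  leaf-walk : ∀ {k i y} → Reach H (suc k) (leaf i) y → leaf i ≡ y ⊎ Reach H k (base i) y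
  leaf-walk r with Reach-suc r
  ... | inj₁ e = inj₁ e
  ... | inj₂ (w , a , r′) with leaf-adj⁻ a
  ...   | refl = inj₂ r′

  leaf-base-far : ∀ {k i j} → i ≢ j → Reach H k (leaf i) (base j) → 2 ≤ k
  leaf-base-far {zero}        _   r = ⊥-elim (leaf≢base (Reach-zero r))
  leaf-base-far {suc zero}    i≢j r with leaf-walk r
  ... | inj₁ e  = ⊥-elim (leaf≢base e)
  ... | inj₂ r′ = ⊥-elim (i≢j (base-injective (Reach-zero r′)))
  leaf-base-far {suc (suc k)} _   _ = s≤s (s≤s z≤n)

  leaves-far : ∀ {k i j} → i ≢ j → Reach H k (leaf i) (leaf j) → 3 ≤ k
  leaves-far {zero}  i≢j r = ⊥-elim (i≢j (leaf-injective (Reach-zero r)))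
  leaves-far {suc k} i≢j r with leaf-walk r
  ... | inj₁ e  = ⊥-elim (i≢j (leaf-injective e))
  ... | inj₂ r′ = s≤s (leaf-base-far (i≢j ∘ sym) (Reach-sym r′))

  leaf-base-near : ∀ {i j} → i ≢ j → Reach H 2 (leaf i) (base j) → Adj G i j
  leaf-base-near i≢j r with leaf-walk r
  ... | inj₁ e  = ⊥-elim (leaf≢base e)
  ... | inj₂ r′ with Reach-suc r′
  ...   | inj₁ e = ⊥-elim (i≢j (base-injective e))
  ...   | inj₂ (w , a , r″) with Reach-zero r″
  ...     | refl = base-adj⁻ a

  leaves-near : ∀ {i j} → i ≢ j → Reach H 3 (leaf i) (leaf j) → Adj G i j
  leaves-near i≢j r with leaf-walk r
  ... | inj₁ e  = ⊥-elim (i≢j (leaf-injective e))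
  ... | inj₂ r′ = adj-sym G (leaf-base-near (i≢j ∘ sym) (Reach-sym r′))

  base-within-1 : ∀ u → ∃ λ j → ∀ {k y} → Reach H k y (base j) → Reach H (suc k) y u
  base-within-1 u with place u
  ... | at-base j = j , λ r → Reach-mono r (n≤1+n _)
  ... | at-leaf j = j , λ r → Reach-snoc r (base-leaf-adj j)

  onLeaves : Vector ℕ n → Vector ℕ (n + n)
  onLeaves g = replicate n 0 ++ g

  onLeaves-base : ∀ g i → onLeaves g (base i) ≡ 0
  onLeaves-base g i = lookup-++ˡ (replicate n 0) g i

  onLeaves-leaf : ∀ g i → onLeaves g (leaf i) ≡ g i
  onLeaves-leaf g i = lookup-++ʳ (replicate n 0) g i

  sum-onLeaves : ∀ g → sum (onLeaves g) ≡ sum g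
  sum-onLeaves g = trans (sum-++ (replicate n 0) g) (cong (_+ sum g) (sum-replicate-zero n))

  module LowerBound (S : Subset n) (independent : Independent G S) where

    strength : Fin n → ℕ
    strength i = suc (indicator (Vec.lookup S i))

    f₀ : Fin (n + n) → ℕ
    f₀ = onLeaves strength

    strength≤2 : ∀ i → strength i ≤ 2
    strength≤2 i with Vec.lookup S i
    ... | true  = ≤-refl
    ... | false = s≤s z≤n

    adjacent-strengths : ∀ {i j} → Adj G i j → strength i + strength j ≤ 3
    adjacent-strengths {i} {j} a with Vec.lookup S i in Si | Vec.lookup S j in Sj
    ... | true  | true  = ⊥-elim (independent i j (lookup⇒[]= i S Si) (lookup⇒[]= j S Sj) a)
    ... | true  | false = ≤-refl
    ... | false | true  = ≤-refl
    ... | false | false = s≤s (s≤s z≤n)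

    leaf-strengths≤ : ∀ {k i j} → i ≢ j → Reach H k (leaf i) (leaf j) → strength i + strength j ≤ k
    leaf-strengths≤ {k} {i} {j} i≢j r with k ≤? 3
    ... | yes k≤3 = ≤-trans (adjacent-strengths (leaves-near i≢j (Reach-mono r k≤3))) (leaves-far i≢j r)
    ... | no  k≰3 = ≤-trans (+-mono-≤ (strength≤2 i) (strength≤2 j)) (≰⇒> k≰3)

    base-silent : ∀ i → ¬ (0 < f₀ (base i))
    base-silent i f₀>0 with subst (0 <_) (onLeaves-base strength i) f₀>0
    ... | ()

    f₀-separated : Separated f₀
    f₀-separated {k} {v} {w} v≢w v>0 w>0 r with place v | place w
    ... | at-base i | _         = ⊥-elim (base-silent i v>0)
    ... | at-leaf _ | at-base j = ⊥-elim (base-silent j w>0)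
    ... | at-leaf i | at-leaf j = begin
      f₀ (leaf i) + f₀ (leaf j) ≡⟨ cong₂ _+_ (onLeaves-leaf strength i) (onLeaves-leaf strength j) ⟩
      strength i + strength j   ≤⟨ leaf-strengths≤ (v≢w ∘ cong leaf) r ⟩
      k                         ∎
      where open ≤-Reasoning

    f₀-broadcast : 2 ≤ n → IsBroadcast H f₀
    f₀-broadcast 2≤n x with place x
    ... | at-base i = base i , λ m _ → ≤-trans (≤-reflexive (onLeaves-base strength i)) z≤n
    ... | at-leaf i with another 2≤n i
    ...   | j , j≢i = leaf j , λ m r → begin
      f₀ (leaf i) ≡⟨ onLeaves-leaf strength i ⟩
      strength i  ≤⟨ strength≤2 i ⟩
      2           ≤⟨ n≤1+n 2 ⟩
      3           ≤⟨ leaves-far (j≢i ∘ sym) r ⟩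
      m           ∎
      where open ≤-Reasoning

    f₀-bn : 2 ≤ n → IsBNBroadcast H f₀
    f₀-bn 2≤n = f₀-broadcast 2≤n , separated⇒boundaryIndependent f₀-separated

    cost-f₀ : cost f₀ ≡ n + ∣ S ∣
    cost-f₀ = begin
      cost f₀                                  ≡⟨ cost≡sum f₀ ⟩
      sum f₀                                   ≡⟨ sum-onLeaves strength ⟩
      sum strength                             ≡⟨ sum-suc (indicator ∘ Vec.lookup S) ⟩
      n + sum (indicator ∘ Vec.lookup S)       ≡⟨ cong (n +_) (∣p∣≡sum-indicator S) ⟨
      n + ∣ S ∣                                ∎
      where open ≡-Reasoning

  module UpperBound (connected : Connected G) {f : Fin (n + n) → ℕ} (bn : IsBNBroadcast H f) where

    HearsOnly : Fin (n + n) → Fin (n + n) → Set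
    HearsOnly u x = Hears H f u x × (∀ w → Hears H f u w → w ≡ x)

    interior-hearsOnly : ∀ {x u} → 0 < f x → Reach H (pred (f x)) x u → HearsOnly u x
    interior-hearsOnly {x} {u} fx>0 r = (fx>0 , Reach-mono r pred[n]≤n) , proj₂ bn x fx>0 u r

    hears-own-leaf : ∀ {g} → 0 < f (leaf g) → Hears H f (base g) (leaf g)
    hears-own-leaf {g} fx>0 = fx>0 , Reach-mono (step (leaf-base-adj g) here) fx>0

    Owns : Fin (n + n) → Fin n → Set
    Owns x g = (x ≡ leaf g × 0 < f x) ⊎ HearsOnly (base g) x

    owner-unique : ∀ {x y g} → Owns x g → Owns y g → x ≡ y
    owner-unique (inj₁ (refl , _))    (inj₁ (refl , _))    = refl
    owner-unique (inj₁ (refl , fx>0)) (inj₂ (_ , only))    = only _ (hears-own-leaf fx>0)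
    owner-unique (inj₂ (_ , only))    (inj₁ (refl , fy>0)) = sym (only _ (hears-own-leaf fy>0))
    owner-unique (inj₂ (hears , _))   (inj₂ (_ , only))    = only _ hears

    bigLeaves : Subset n
    bigLeaves = Vec.tabulate (λ i → 2 ≤ᵇ f (leaf i))

    ∈bigLeaves⇒2≤ : ∀ {i} → i ∈ bigLeaves → 2 ≤ f (leaf i)
    ∈bigLeaves⇒2≤ {i} i∈ = ≤ᵇ⇒≤ 2 _ (subst T (sym big) _)
      where
      big : (2 ≤ᵇ f (leaf i)) ≡ true
      big = trans (sym (lookup∘tabulate (λ j → 2 ≤ᵇ f (leaf j)) i)) ([]=⇒lookup i∈)

    -- The base of a big leaf lies strictly inside its ball, yet hears an adjacent big leaf.
    bigLeaves-independent : Independent G bigLeaves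
    bigLeaves-independent i j i∈ j∈ a = irrefl G (subst (Adj G i) (leaf-injective j≡i) a)
      where
      j≡i : leaf j ≡ leaf i
      j≡i = proj₂ (interior-hearsOnly (≤-trans (s≤s z≤n) (∈bigLeaves⇒2≤ i∈))
                     (Reach-mono (step (leaf-base-adj i) here) (suc[m]≤n⇒m≤pred[n] (∈bigLeaves⇒2≤ i∈))))
              (leaf j)
              (≤-trans (s≤s z≤n) (∈bigLeaves⇒2≤ j∈) ,
               Reach-mono (step (leaf-base-adj j) (step (base-adj (adj-sym G a)) here)) (∈bigLeaves⇒2≤ j∈))

    bonus : Fin (n + n) → ℕ
    bonus = onLeaves (indicator ∘ Vec.lookup bigLeaves)

    sum-bonus : sum bonus ≡ ∣ bigLeaves ∣
    sum-bonus = trans (sum-onLeaves _) (sym (∣p∣≡sum-indicator bigLeaves))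

    bonus-bigLeaf : ∀ {i k} → f (leaf i) ≡ suc (suc k) → bonus (leaf i) ≡ 1
    bonus-bigLeaf {i} fx = trans (onLeaves-leaf _ i)
      (cong indicator (trans (lookup∘tabulate (λ j → 2 ≤ᵇ f (leaf j)) i) (cong (2 ≤ᵇ_) fx)))

    eccentric-base : ∀ x → ∃ λ j → ∀ {d i m} → Reach H d x (base i) → Reach G m i j → f x ≤ suc (d + m)
    eccentric-base x with proj₁ bn x
    ... | u , eccentric with base-within-1 u
    ...   | j , into-u = j , λ x→i w → eccentric _ (into-u (Reach-++ x→i (lift w)))

    owned-ball : ∀ {d x i k} → Reach H d x (base i) → f x ≡ d + suc k →
      ∃ λ ys → Unique ys × length ys ≡ suc k × All (Owns x) ys
    owned-ball {d} {x} {i} {k} x→i fx =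
      let (j , eccentric) = eccentric-base x
          (ys , unique , length≡ , near) =
            Walks.ball-lower-bound G (proj₂ (connected i j)) (λ w → far (eccentric x→i w))
      in ys , unique , length≡ , All.map owned near
      where
      fx≡ : f x ≡ suc (d + k)
      fx≡ = trans fx (+-suc d k)
      far : ∀ {m} → f x ≤ suc (d + m) → k ≤ m
      far {m} le = +-cancelˡ-≤ d k m (s≤s⁻¹ (subst (_≤ suc (d + m)) fx≡ le))
      owned : ∀ {g} → Reach G k i g → Owns x g
      owned {g} w = inj₂ (interior-hearsOnly (subst (0 <_) (sym fx≡) z<s)
        (subst (λ l → Reach H l x (base g)) (cong pred (sym fx≡)) (Reach-++ x→i (lift w))))

    record Charge (x : Fin (n + n)) : Set where
      constructor charged
      field
        owned        : List (Fin n)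
        owned-unique : Unique owned
        owns-owned   : All (Owns x) owned
        strength≤    : f x ≤ length owned + bonus x

    no-charge : ∀ {x} → f x ≡ 0 → Charge x
    no-charge fx = charged [] [] [] (≤-trans (≤-reflexive fx) z≤n)

    charge-base : ∀ i k → f (base i) ≡ k → Charge (base i)
    charge-base i zero    fx = no-charge fx
    charge-base i (suc k) fx =
      let (ys , unique , length≡ , owns) = owned-ball {d = 0} here fx
      in charged ys unique owns (begin
        f (base i)                ≡⟨ trans fx (sym length≡) ⟩
        length ys                 ≤⟨ m≤m+n _ _ ⟩
        length ys + bonus (base i) ∎)
      where open ≤-Reasoning

    charge-leaf : ∀ i k → f (leaf i) ≡ k → Charge (leaf i)
    charge-leaf i zero          fx = no-charge fx
    charge-leaf i (suc zero)    fx =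
      charged [ i ] ([] ∷ []) (inj₁ (refl , subst (0 <_) (sym fx) z<s) ∷ []) (≤-trans (≤-reflexive fx) (m≤m+n 1 _))
    charge-leaf i (suc (suc k)) fx =
      let (ys , unique , length≡ , owns) = owned-ball {d = 1} (step (leaf-base-adj i) here) fx
      in charged ys unique owns (≤-reflexive (begin
        f (leaf i)                ≡⟨ fx ⟩
        suc (suc k)               ≡⟨ +-comm 1 (suc k) ⟩
        suc k + 1                 ≡⟨ cong₂ _+_ length≡ (bonus-bigLeaf fx) ⟨
        length ys + bonus (leaf i) ∎))
      where open ≡-Reasoning

    charge : ∀ x → Charge x
    charge x with place x
    ... | at-base i = charge-base i _ refl
    ... | at-leaf i = charge-leaf i _ refl

    ownedBy : Fin (n + n) → List (Fin n)
    ownedBy = Charge.owned ∘ charge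

    all-owned-unique : Unique (concat (tabulate ownedBy))
    all-owned-unique = Unique.concat⁺ (All.tabulate⁺ (Charge.owned-unique ∘ charge)) (AllPairs.tabulate⁺ disjoint)
      where
      disjoint : ∀ {x y} → x ≢ y → Disjoint (ownedBy x) (ownedBy y)
      disjoint {x} {y} x≢y (g∈x , g∈y) =
        x≢y (owner-unique (All.lookup (Charge.owns-owned (charge x)) g∈x)
                          (All.lookup (Charge.owns-owned (charge y)) g∈y))

    cost≤ : cost f ≤ n + ∣ bigLeaves ∣
    cost≤ = begin
      cost f                                         ≡⟨ cost≡sum f ⟩
      sum f                                          ≤⟨ sum-mono-≤ (Charge.strength≤ ∘ charge) ⟩
      sum (λ x → length (ownedBy x) + bonus x)       ≡⟨ ∑-distrib-+ (length ∘ ownedBy) bonus ⟩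
      sum (length ∘ ownedBy) + sum bonus             ≡⟨ cong₂ _+_ (sym (length-concat-tabulate ownedBy)) sum-bonus ⟩
      length (concat (tabulate ownedBy)) + ∣ bigLeaves ∣ ≤⟨ +-monoˡ-≤ _ (Unique⇒length≤ all-owned-unique) ⟩
      n + ∣ bigLeaves ∣                              ∎
      where open ≤-Reasoning

proposition4p1 : (n : ℕ) → 2 ≤ n → (G : Graph n) → Connected G →
    (a : ℕ) → IsIndependenceNumber G a → IsAlphaBN (corona G) (n + a)
proposition4p1 n 2≤n G connected a ((S , independent , ∣S∣≡a) , maximum) =
  (f₀ , f₀-bn 2≤n , trans cost-f₀ (cong (n +_) ∣S∣≡a)) ,
  λ f bn → let open UpperBound connected bn in
    ≤-trans cost≤ (+-monoʳ-≤ n (maximum bigLeaves bigLeaves-independent))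
  where
  open Corona G
  open LowerBound S independent
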